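{- Let $k\in\{6,7\}$ and let $h_1\ge\dots\ge h_k>0$ be integers. If a $\mathrm{LS}(h_1\dots h_k)$ exists, then for every subset $D\subseteq[k]$, with $\overline{D}=[k]\setminus D$, $$(2k-2-3|D|)\sum_{j\in\overline{D}}h_j\ \ge\ (k+2-3|D|)\sum_{i\in D}h_i.$$
   Context: $[k]=\{1,\dots,k\}$. A latin square of order $n$ is an $n\times n$ array on $n$ symbols in which each symbol occurs exactly once in each row and each column. A subsquare is an $m\times m$ sub-array which is itself a latin square of order $m$; subsquares are disjoint if they share no row, column or symbol. For a partition $(h_1,\dots,h_k)$ of $n=\sum h_i$, a $\mathrm{LS}(h_1\dots h_k)$ is a latin square of order $n$ with pairwise disjoint subsquares of orders $h_1,\dots,h_k$. -}

module Defs where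

open import Data.Nat using (ℕ; zero; suc)
open import Data.Fin using (Fin; zero; suc)
open import Data.Fin.Subset using (Subset; _∈_; _∉_; ∣_∣; _∩_; Empty)
open import Data.Integer using (ℤ; +_; _+_; 0ℤ)
open import Data.Product using (Σ; _×_; _,_; ∃)
open import Relation.Binary.PropositionalEquality using (_≡_; _≢_)
open import Function.Definitions using (Injective; Surjective)

record IsLatinSquare (n : ℕ) (L : Fin n → Fin n → Fin n) : Set where
  field
    rowOnce : ∀ r s → Σ (Fin n) λ c → (L r c ≡ s) × (∀ c′ → L r c′ ≡ s → c′ ≡ c)
    colOnce : ∀ c s → Σ (Fin n) λ r → (L r c ≡ s) × (∀ r′ → L r′ c ≡ s → r′ ≡ r)

-- A subsquare of order m of L: a set R of m rows, a set C of m columns,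
-- such that the m×m sub-array R×C is a latin square of order m, i.e.
-- its entries lie in a set S of m symbols (then every symbol of S occurs
-- exactly once in each row and column of the sub-array, since L is latin).
record Subsquare (n : ℕ) (L : Fin n → Fin n → Fin n) (m : ℕ) : Set where
  field
    rows cols syms : Subset n
    ∣rows∣ : ∣ rows ∣ ≡ m
    ∣cols∣ : ∣ cols ∣ ≡ m
    ∣syms∣ : ∣ syms ∣ ≡ m
    closed : ∀ r c → r ∈ rows → c ∈ cols → L r c ∈ syms

Disjoint : ∀ {n L m m′} → Subsquare n L m → Subsquare n L m′ → Set
Disjoint S T = Empty (rows S ∩ rows T) × Empty (cols S ∩ cols T) × Empty (syms S ∩ syms T)
  where open Subsquare

sumFin : (k : ℕ) → (Fin k → ℕ) → ℕ
sumFin zero f = 0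
sumFin (suc k) f = f zero Data.Nat.+ sumFin k (λ i → f (suc i))

sumOver : ∀ {k} → Subset k → (Fin k → ℕ) → ℤ
sumOver {k} D h = + (sumFin k (λ i → ind i * h i))
  where
    open import Data.Nat using (_*_)
    open import Data.Vec using (lookup)
    open import Data.Fin.Subset using (inside; outside)
    ind : Fin k → ℕ
    ind i with lookup D i
    ... | inside = 1
    ... | outside = 0

record LS (k : ℕ) (h : Fin k → ℕ) : Set where
  field
    L : Fin (sumFin k h) → Fin (sumFin k h) → Fin (sumFin k h)
    latin : IsLatinSquare (sumFin k h) L
    sub : (i : Fin k) → Subsquare (sumFin k h) L (h i)
    disjoint : ∀ i j → i ≢ j → Disjoint (sub i) (sub j)

open Data.Fin.Subset using (∁) public

-- Fix a column c of the subsquare Sⱼ and look at the hᵢ entries of c in the rows of a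
-- different subsquare Sᵢ.  Row r of Sᵢ already uses every symbol of Sᵢ inside Sᵢ, and
-- column c already uses every symbol of Sⱼ inside Sⱼ, so these hᵢ distinct entries avoid
-- the hᵢ + hⱼ symbols of both subsquares: 2hᵢ + hⱼ ≤ n.  For |D| = 1 this bound for one
-- pair, and for |D| = 2 its sum over both orderings of the pair, give the inequality; for
-- |D| = 0 it is trivial and for |D| = 3 its coefficients have opposite signs.  Replacing D
-- by its complement only multiplies the inequality by -1, which covers |D| ≥ 4.
module Submission where

open import Defs
open import Data.Nat using (ℕ; _≥_; _>_)
open import Data.Fin using (Fin; suc; zero; _≤_; toℕ)
open import Data.Fin.Subset using (Subset; ∣_∣; ∁)
open import Data.Integer using (ℤ; +_; _-_; _*_) renaming (_≤_ to _≤ℤ_)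
open import Data.Sum using (_⊎_)
open import Relation.Binary.PropositionalEquality using (_≡_)

open import Data.Nat as ℕ using (zero; suc; _+_; _∸_; z≤n; s≤s; _≤?_)
open import Data.Nat.Properties as ℕ
  using (≤-refl; ≤-trans; ≤-reflexive; <-irrefl; ≤-<-trans; module ≤-Reasoning)
import Data.Nat.Tactic.RingSolver as ℕ-Ring
open import Algebra.Properties.CommutativeSemigroup ℕ.+-commutativeSemigroup using (x∙yz≈y∙xz)
open import Data.Integer as ℤ using (-_)
open import Data.Integer.Properties as ℤ using (pos-+; pos-*)
import Data.Integer.Tactic.RingSolver as ℤ-Ring
open import Data.Fin.Properties using (suc-injective; 0≢1+n)
open import Data.Fin.Subset
  using (_∈_; _∉_; _∪_; _∩_; Empty; Nonempty; inside; outside) renaming (_-_ to _-ₛ_)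
open import Data.Fin.Subset.Properties
open import Data.Vec using ([]; _∷_; here; there)
open import Data.Product using (∃; _×_; _,_; proj₁; proj₂)
open import Data.Sum using (inj₁; inj₂; [_,_]′)
open import Data.Unit using (⊤; tt)
open import Data.Empty using (⊥-elim)
open import Function using (_∘_)
open import Function.Definitions using (Injective)
open import Relation.Nullary using (yes; no)
open import Relation.Binary.PropositionalEquality
  using (_≢_; refl; sym; trans; cong; cong₂; subst; subst₂; module ≡-Reasoning)

MapsTo : ∀ {m n} → (Fin m → Fin n) → Subset m → Subset n → Set
MapsTo f p q = ∀ {x} → x ∈ p → f x ∈ q

InjectiveOn : ∀ {m n} → (Fin m → Fin n) → Subset m → Set
InjectiveOn f p = ∀ {x y} → x ∈ p → y ∈ p → f x ≡ f y → x ≡ y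

∣p∣≤∣q∣-by-injection : ∀ {m n} (p : Subset m) (q : Subset n) (f : Fin m → Fin n) →
  MapsTo f p q → InjectiveOn f p → ∣ p ∣ ℕ.≤ ∣ q ∣
∣p∣≤∣q∣-by-injection [] q f _ _ = z≤n
∣p∣≤∣q∣-by-injection (outside ∷ p) q f into inj =
  ∣p∣≤∣q∣-by-injection p q (f ∘ suc) (into ∘ there)
    (λ x∈ y∈ e → suc-injective (inj (there x∈) (there y∈) e))
∣p∣≤∣q∣-by-injection (inside ∷ p) q f into inj =
  ≤-trans (s≤s (∣p∣≤∣q∣-by-injection p (q -ₛ f zero) (f ∘ suc) into′ inj′))
          (x∈p⇒∣p-x∣<∣p∣ (into here))
  where
  into′ : MapsTo (f ∘ suc) p (q -ₛ f zero)
  into′ x∈ = x∈p∧x≢y⇒x∈p-y (into (there x∈)) (λ e → 0≢1+n (sym (inj (there x∈) here e)))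
  inj′ : InjectiveOn (f ∘ suc) p
  inj′ x∈ y∈ e = suc-injective (inj (there x∈) (there y∈) e)

-- Such an injection is onto q, so nothing outside p is sent into q.
mapsTo-∉ : ∀ {n} (p q : Subset n) (g : Fin n → Fin n) → ∣ p ∣ ≡ ∣ q ∣ →
  MapsTo g p q → Injective _≡_ _≡_ g → ∀ {x} → x ∉ p → g x ∉ q
mapsTo-∉ p q g ∣p∣≡∣q∣ into inj {x} x∉p gx∈q =
  <-irrefl ∣p∣≡∣q∣ (≤-<-trans (∣p∣≤∣q∣-by-injection p (q -ₛ g x) g into′ (λ _ _ → inj))
                             (x∈p⇒∣p-x∣<∣p∣ gx∈q))
  where
  into′ : MapsTo g p (q -ₛ g x)
  into′ y∈ = x∈p∧x≢y⇒x∈p-y (into y∈) (λ e → x∉p (subst (_∈ p) (inj e) y∈))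

∣p∪q∣≡∣p∣+∣q∣ : ∀ {n} (p q : Subset n) → Empty (p ∩ q) → ∣ p ∪ q ∣ ≡ ∣ p ∣ + ∣ q ∣
∣p∪q∣≡∣p∣+∣q∣ [] [] _ = refl
∣p∪q∣≡∣p∣+∣q∣ (inside ∷ p) (inside ∷ q) disj = ⊥-elim (disj (zero , here))
∣p∪q∣≡∣p∣+∣q∣ (inside ∷ p) (outside ∷ q) disj =
  cong suc (∣p∪q∣≡∣p∣+∣q∣ p q (drop-∷-Empty disj))
∣p∪q∣≡∣p∣+∣q∣ (outside ∷ p) (inside ∷ q) disj =
  trans (cong suc (∣p∪q∣≡∣p∣+∣q∣ p q (drop-∷-Empty disj))) (sym (ℕ.+-suc ∣ p ∣ ∣ q ∣))
∣p∪q∣≡∣p∣+∣q∣ (outside ∷ p) (outside ∷ q) disj = ∣p∪q∣≡∣p∣+∣q∣ p q (drop-∷-Empty disj)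

0<∣p∣⇒Nonempty : ∀ {n} (p : Subset n) → 0 ℕ.< ∣ p ∣ → Nonempty p
0<∣p∣⇒Nonempty (inside ∷ p) _ = zero , here
0<∣p∣⇒Nonempty (outside ∷ p) 0<∣p∣ with 0<∣p∣⇒Nonempty p 0<∣p∣
... | x , x∈p = suc x , there x∈p

∁-involutive : ∀ {n} (p : Subset n) → ∁ (∁ p) ≡ p
∁-involutive [] = refl
∁-involutive (inside ∷ p) = cong (inside ∷_) (∁-involutive p)
∁-involutive (outside ∷ p) = cong (outside ∷_) (∁-involutive p)

module _ {n} {L : Fin n → Fin n → Fin n} (latin : IsLatinSquare n L) where
  open IsLatinSquare latin

  row-injective : ∀ r → Injective _≡_ _≡_ (L r)
  row-injective r {c₁} {c₂} e with rowOnce r (L r c₁)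
  ... | c , _ , unique = trans (unique c₁ refl) (sym (unique c₂ (sym e)))

  column-injective : ∀ c → Injective _≡_ _≡_ (λ r → L r c)
  column-injective c {r₁} {r₂} e with colOnce c (L r₁ c)
  ... | r , _ , unique = trans (unique r₁ refl) (sym (unique r₂ (sym e)))

  disjointSubsquares⇒a+[a+b]≤n : ∀ {a b} (S : Subsquare n L a) (T : Subsquare n L b) →
    Disjoint S T → 0 ℕ.< b → a + (a + b) ℕ.≤ n
  disjointSubsquares⇒a+[a+b]≤n {a} {b} S T (rows-disj , cols-disj , syms-disj) 0<b =
    ℕ.m≤o∸n⇒m+n≤o a ∣U∣≤n (begin
      a                  ≡⟨ sym (∣rows∣ S) ⟩
      ∣ rows S ∣         ≤⟨ ∣p∣≤∣q∣-by-injection (rows S) (∁ U) (λ r → L r c) into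
                              (λ _ _ → column-injective c) ⟩
      ∣ ∁ U ∣            ≡⟨ ∣∁p∣≡n∸∣p∣ U ⟩
      n ∸ ∣ U ∣          ≡⟨ cong (n ∸_) ∣U∣≡a+b ⟩
      n ∸ (a + b)        ∎)
    where
    open Subsquare
    open ≤-Reasoning
    U = syms S ∪ syms T
    ∣U∣≡a+b : ∣ U ∣ ≡ a + b
    ∣U∣≡a+b = trans (∣p∪q∣≡∣p∣+∣q∣ (syms S) (syms T) syms-disj)
                    (cong₂ _+_ (∣syms∣ S) (∣syms∣ T))
    ∣U∣≤n : a + b ℕ.≤ n
    ∣U∣≤n = subst (ℕ._≤ n) ∣U∣≡a+b (∣p∣≤n U)
    cols-nonempty : Nonempty (cols T)
    cols-nonempty = 0<∣p∣⇒Nonempty (cols T) (subst (0 ℕ.<_) (sym (∣cols∣ T)) 0<b)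
    c : Fin n
    c = proj₁ cols-nonempty
    c∈T : c ∈ cols T
    c∈T = proj₂ cols-nonempty
    into : MapsTo (λ r → L r c) (rows S) (∁ U)
    into {r} r∈S = x∉p⇒x∈∁p (λ m → [ ∉symsS , ∉symsT ]′ (x∈p∪q⁻ (syms S) (syms T) m))
      where
      ∉symsS : L r c ∉ syms S
      ∉symsS = mapsTo-∉ (cols S) (syms S) (L r) (trans (∣cols∣ S) (sym (∣syms∣ S)))
                 (closed S r _ r∈S) (row-injective r)
                 (λ c∈S → cols-disj (c , x∈p∩q⁺ (c∈S , c∈T)))
      ∉symsT : L r c ∉ syms T
      ∉symsT = mapsTo-∉ (rows T) (syms T) (λ r′ → L r′ c) (trans (∣rows∣ T) (sym (∣syms∣ T)))
                 (λ r′∈T → closed T _ c r′∈T c∈T) (column-injective c)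
                 (λ r∈T → rows-disj (r , x∈p∩q⁺ (r∈S , r∈T)))

LS⇒hᵢ+[hᵢ+hⱼ]≤n : ∀ {k} {h : Fin k → ℕ} → LS k h → (∀ i → h i > 0) →
  ∀ i j → i ≢ j → h i + (h i + h j) ℕ.≤ sumFin k h
LS⇒hᵢ+[hᵢ+hⱼ]≤n ls pos i j i≢j =
  disjointSubsquares⇒a+[a+b]≤n latin (sub i) (sub j) (disjoint i j i≢j) (pos j)
  where open LS ls

subsetSum : ∀ {k} → Subset k → (Fin k → ℕ) → ℕ
subsetSum [] h = 0
subsetSum (inside ∷ D) h = h zero + subsetSum D (h ∘ suc)
subsetSum (outside ∷ D) h = subsetSum D (h ∘ suc)

sumOver≡+subsetSum : ∀ {k} (D : Subset k) h → sumOver D h ≡ + subsetSum D h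
sumOver≡+subsetSum [] h = refl
sumOver≡+subsetSum (inside ∷ D) h =
  cong₂ ℤ._+_ (cong +_ (ℕ.+-identityʳ (h zero))) (sumOver≡+subsetSum D (h ∘ suc))
sumOver≡+subsetSum (outside ∷ D) h = sumOver≡+subsetSum D (h ∘ suc)

subsetSum+subsetSum-∁ : ∀ {k} (D : Subset k) h →
  subsetSum D h + subsetSum (∁ D) h ≡ sumFin k h
subsetSum+subsetSum-∁ [] h = refl
subsetSum+subsetSum-∁ (inside ∷ D) h =
  trans (ℕ.+-assoc (h zero) _ _) (cong (_+_ (h zero)) (subsetSum+subsetSum-∁ D (h ∘ suc)))
subsetSum+subsetSum-∁ (outside ∷ D) h =
  trans (x∙yz≈y∙xz (subsetSum D (h ∘ suc)) (h zero) _)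
        (cong (_+_ (h zero)) (subsetSum+subsetSum-∁ D (h ∘ suc)))

subsetSum-∣0∣ : ∀ {k} (D : Subset k) h → ∣ D ∣ ≡ 0 → subsetSum D h ≡ 0
subsetSum-∣0∣ [] h _ = refl
subsetSum-∣0∣ (outside ∷ D) h ∣D∣≡0 = subsetSum-∣0∣ D (h ∘ suc) ∣D∣≡0

subsetSum-∣1∣ : ∀ {k} (D : Subset k) h → ∣ D ∣ ≡ 1 → ∃ λ i → subsetSum D h ≡ h i
subsetSum-∣1∣ (inside ∷ D) h ∣D∣≡1 =
  zero , trans (cong (_+_ (h zero)) (subsetSum-∣0∣ D (h ∘ suc) (ℕ.suc-injective ∣D∣≡1)))
               (ℕ.+-identityʳ (h zero))
subsetSum-∣1∣ (outside ∷ D) h ∣D∣≡1 with subsetSum-∣1∣ D (h ∘ suc) ∣D∣≡1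
... | i , sum≡hᵢ = suc i , sum≡hᵢ

subsetSum-∣2∣ : ∀ {k} (D : Subset k) h → ∣ D ∣ ≡ 2 →
  ∃ λ i → ∃ λ j → i ≢ j × subsetSum D h ≡ h i + h j
subsetSum-∣2∣ (inside ∷ D) h ∣D∣≡2 with subsetSum-∣1∣ D (h ∘ suc) (ℕ.suc-injective ∣D∣≡2)
... | j , sum≡hⱼ = zero , suc j , (λ ()) , cong (_+_ (h zero)) sum≡hⱼ
subsetSum-∣2∣ (outside ∷ D) h ∣D∣≡2 with subsetSum-∣2∣ D (h ∘ suc) ∣D∣≡2
... | i , j , i≢j , sum≡hᵢ+hⱼ = suc i , suc j , i≢j ∘ suc-injective , sum≡hᵢ+hⱼ

SmallSetBounds : ℕ → ℕ → ℕ → Set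
SmallSetBounds 0 A B = A ≡ 0
SmallSetBounds 1 A B = A ℕ.≤ B
SmallSetBounds 2 A B = A ℕ.≤ 2 ℕ.* B
SmallSetBounds (suc (suc (suc _))) A B = ⊤

∃≢ : ∀ {k} → 2 ℕ.≤ k → (i : Fin k) → ∃ λ j → i ≢ j
∃≢ (s≤s (s≤s _)) zero = suc zero , λ ()
∃≢ (s≤s (s≤s _)) (suc i) = zero , λ ()

a+[a+b]≤a+b+B⇒a+b≤2B : ∀ a b B →
  a + (a + b) ℕ.≤ a + b + B → b + (b + a) ℕ.≤ a + b + B → a + b ℕ.≤ 2 ℕ.* B
a+[a+b]≤a+b+B⇒a+b≤2B a b B ineqᵃ ineqᵇ =
  ℕ.+-cancelˡ-≤ (2 ℕ.* (a + b)) (a + b) (2 ℕ.* B)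
    (subst₂ ℕ._≤_ (lhs a b) (rhs a b B) (ℕ.+-mono-≤ ineqᵃ ineqᵇ))
  where
  lhs : ∀ a b → a + (a + b) + (b + (b + a)) ≡ 2 ℕ.* (a + b) + (a + b)
  lhs = ℕ-Ring.solve-∀
  rhs : ∀ a b B → a + b + B + (a + b + B) ≡ 2 ℕ.* (a + b) + 2 ℕ.* B
  rhs = ℕ-Ring.solve-∀

module _ {k} (h : Fin k → ℕ) (2≤k : 2 ℕ.≤ k)
  (pairBound : ∀ i j → i ≢ j → h i + (h i + h j) ℕ.≤ sumFin k h) where

  smallSetBounds : ∀ D → SmallSetBounds ∣ D ∣ (subsetSum D h) (subsetSum (∁ D) h)
  smallSetBounds D with ∣ D ∣ in ∣D∣≡d
  ... | 0 = subsetSum-∣0∣ D h ∣D∣≡d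
  ... | 1 with subsetSum-∣1∣ D h ∣D∣≡d
  ...   | i , A≡hᵢ with ∃≢ 2≤k i
  ...     | j , i≢j = begin
      subsetSum D h        ≡⟨ A≡hᵢ ⟩
      h i                  ≤⟨ ℕ.+-cancelˡ-≤ (h i) (h i) B 2hᵢ≤hᵢ+B ⟩
      B                    ∎
    where
    open ≤-Reasoning
    B = subsetSum (∁ D) h
    2hᵢ≤hᵢ+B : h i + h i ℕ.≤ h i + B
    2hᵢ≤hᵢ+B = begin
      h i + h i            ≤⟨ ℕ.+-monoʳ-≤ (h i) (ℕ.m≤m+n (h i) (h j)) ⟩
      h i + (h i + h j)    ≤⟨ pairBound i j i≢j ⟩
      sumFin k h           ≡⟨ sym (subsetSum+subsetSum-∁ D h) ⟩
      subsetSum D h + B    ≡⟨ cong (_+ B) A≡hᵢ ⟩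
      h i + B              ∎
  smallSetBounds D | 2 with subsetSum-∣2∣ D h ∣D∣≡d
  ... | i , j , i≢j , A≡hᵢ+hⱼ =
    subst (ℕ._≤ 2 ℕ.* B) (sym A≡hᵢ+hⱼ)
      (a+[a+b]≤a+b+B⇒a+b≤2B (h i) (h j) B
        (subst (h i + (h i + h j) ℕ.≤_) total (pairBound i j i≢j))
        (subst (h j + (h j + h i) ℕ.≤_) total (pairBound j i (i≢j ∘ sym))))
    where
    B = subsetSum (∁ D) h
    total : sumFin k h ≡ h i + h j + B
    total = trans (sym (subsetSum+subsetSum-∁ D h)) (cong (_+ B) A≡hᵢ+hⱼ)
  smallSetBounds D | suc (suc (suc _)) = tt

lhsCoeff rhsCoeff : ℕ → ℕ → ℤ
lhsCoeff k d = + (k + 2) - + (3 ℕ.* d)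
rhsCoeff k d = + (2 ℕ.* k) - + 2 - + (3 ℕ.* d)

Bound : ℕ → ℕ → ℕ → ℕ → Set
Bound k d A B = lhsCoeff k d * + A ≤ℤ rhsCoeff k d * + B

+[m∸n]≡+m-+n : ∀ {m n} → n ℕ.≤ m → + (m ∸ n) ≡ + m - + n
+[m∸n]≡+m-+n {m} {n} n≤m = trans (sym (ℤ.⊖-≥ n≤m)) (sym (ℤ.m-n≡m⊖n m n))

lhsCoeff≡ : ∀ k d → lhsCoeff k d ≡ + k ℤ.+ + 2 - + 3 * + d
lhsCoeff≡ k d = cong₂ _-_ (pos-+ k 2) (pos-* 3 d)

rhsCoeff≡ : ∀ k d → rhsCoeff k d ≡ + 2 * + k - + 2 - + 3 * + d
rhsCoeff≡ k d = cong₂ _-_ (cong (_- + 2) (pos-* 2 k)) (pos-* 3 d)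

+3*+[k∸d]≡ : ∀ {k d} → d ℕ.≤ k → + 3 * + (k ∸ d) ≡ + 3 * (+ k - + d)
+3*+[k∸d]≡ d≤k = cong (λ x → + 3 * x) (+[m∸n]≡+m-+n d≤k)

neg-lhsCoeff-∸ : ∀ {k d} → d ℕ.≤ k → - lhsCoeff k (k ∸ d) ≡ rhsCoeff k d
neg-lhsCoeff-∸ {k} {d} d≤k = begin
  - lhsCoeff k (k ∸ d)                        ≡⟨ cong -_ (lhsCoeff≡ k (k ∸ d)) ⟩
  - (+ k ℤ.+ + 2 - + 3 * + (k ∸ d))           ≡⟨ cong (λ x → - (+ k ℤ.+ + 2 - x)) (+3*+[k∸d]≡ d≤k) ⟩
  - (+ k ℤ.+ + 2 - + 3 * (+ k - + d))         ≡⟨ ring (+ k) (+ d) ⟩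
  + 2 * + k - + 2 - + 3 * + d                 ≡⟨ rhsCoeff≡ k d ⟨
  rhsCoeff k d                                ∎
  where
  open ≡-Reasoning
  ring : ∀ K δ → - (K ℤ.+ + 2 - + 3 * (K - δ)) ≡ + 2 * K - + 2 - + 3 * δ
  ring = ℤ-Ring.solve-∀

neg-rhsCoeff-∸ : ∀ {k d} → d ℕ.≤ k → - rhsCoeff k (k ∸ d) ≡ lhsCoeff k d
neg-rhsCoeff-∸ {k} {d} d≤k = begin
  - rhsCoeff k (k ∸ d)                        ≡⟨ cong -_ (rhsCoeff≡ k (k ∸ d)) ⟩
  - (+ 2 * + k - + 2 - + 3 * + (k ∸ d))       ≡⟨ cong (λ x → - (+ 2 * + k - + 2 - x)) (+3*+[k∸d]≡ d≤k) ⟩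
  - (+ 2 * + k - + 2 - + 3 * (+ k - + d))     ≡⟨ ring (+ k) (+ d) ⟩
  + k ℤ.+ + 2 - + 3 * + d                     ≡⟨ lhsCoeff≡ k d ⟨
  lhsCoeff k d                                ∎
  where
  open ≡-Reasoning
  ring : ∀ K δ → - (+ 2 * K - + 2 - + 3 * (K - δ)) ≡ K ℤ.+ + 2 - + 3 * δ
  ring = ℤ-Ring.solve-∀

Bound-∁ : ∀ {k d A B} → d ℕ.≤ k → Bound k (k ∸ d) B A → Bound k d A B
Bound-∁ {k} {d} {A} {B} d≤k bound =
  subst₂ _≤ℤ_ (negate-coeff A (neg-rhsCoeff-∸ d≤k)) (negate-coeff B (neg-lhsCoeff-∸ d≤k))
    (ℤ.neg-mono-≤ bound)
  where
  negate-coeff : ∀ X {c c′} → - c ≡ c′ → - (c * + X) ≡ c′ * + X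
  negate-coeff X {c} -c≡c′ = trans (ℤ.neg-distribˡ-* c (+ X)) (cong (_* + X) -c≡c′)

+*+-mono-≤ : ∀ p q A B → p ℕ.* A ℕ.≤ q ℕ.* B → + p * + A ≤ℤ + q * + B
+*+-mono-≤ p q A B le = subst₂ _≤ℤ_ (pos-* p A) (pos-* q B) (ℤ.+≤+ le)

-*+≤+*+ : ∀ p q A B → - (+ p) * + A ≤ℤ + q * + B
-*+≤+*+ p q A B =
  subst₂ _≤ℤ_ (trans (cong -_ (pos-* p A)) (ℤ.neg-distribˡ-* (+ p) (+ A))) (pos-* q B) ℤ.neg-≤-pos

*-monoʳ-≤-scaled : ∀ c e {A B} → A ℕ.≤ e ℕ.* B → c ℕ.* A ℕ.≤ (c ℕ.* e) ℕ.* B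
*-monoʳ-≤-scaled c e {A} {B} A≤eB =
  ≤-trans (ℕ.*-monoʳ-≤ c A≤eB) (≤-reflexive (sym (ℕ.*-assoc c e B)))

Bound-≤3 : ∀ {k d A B} → k ≡ 6 ⊎ k ≡ 7 → d ℕ.≤ 3 → SmallSetBounds d A B → Bound k d A B
Bound-≤3 {B = B} (inj₁ refl) z≤n refl = +*+-mono-≤ 8 10 0 B z≤n
Bound-≤3 {A = A} {B} (inj₁ refl) (s≤s z≤n) A≤B =
  +*+-mono-≤ 5 7 A B (ℕ.*-mono-≤ (ℕ.m≤m+n 5 2) A≤B)
Bound-≤3 {A = A} {B} (inj₁ refl) (s≤s (s≤s z≤n)) A≤2B =
  +*+-mono-≤ 2 4 A B (*-monoʳ-≤-scaled 2 2 {B = B} A≤2B)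
Bound-≤3 {A = A} {B} (inj₁ refl) (s≤s (s≤s (s≤s z≤n))) _ = -*+≤+*+ 1 1 A B
Bound-≤3 {B = B} (inj₂ refl) z≤n refl = +*+-mono-≤ 9 12 0 B z≤n
Bound-≤3 {A = A} {B} (inj₂ refl) (s≤s z≤n) A≤B =
  +*+-mono-≤ 6 9 A B (ℕ.*-mono-≤ (ℕ.m≤m+n 6 3) A≤B)
Bound-≤3 {A = A} {B} (inj₂ refl) (s≤s (s≤s z≤n)) A≤2B =
  +*+-mono-≤ 3 6 A B (*-monoʳ-≤-scaled 3 2 {B = B} A≤2B)
Bound-≤3 {A = A} {B} (inj₂ refl) (s≤s (s≤s (s≤s z≤n))) _ = +*+-mono-≤ 0 3 A B z≤n

6≤k×k≤7 : ∀ {k} → k ≡ 6 ⊎ k ≡ 7 → 6 ℕ.≤ k × k ℕ.≤ 7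
6≤k×k≤7 (inj₁ refl) = ≤-refl , ℕ.n≤1+n 6
6≤k×k≤7 (inj₂ refl) = ℕ.n≤1+n 6 , ≤-refl

module _ {k} (k∈67 : k ≡ 6 ⊎ k ≡ 7) (h : Fin k → ℕ)
  (bounds : ∀ D → SmallSetBounds ∣ D ∣ (subsetSum D h) (subsetSum (∁ D) h)) where

  subsetSum-Bound : ∀ D → Bound k ∣ D ∣ (subsetSum D h) (subsetSum (∁ D) h)
  subsetSum-Bound D with ∣ D ∣ ≤? 3
  ... | yes ∣D∣≤3 = Bound-≤3 k∈67 ∣D∣≤3 (bounds D)
  ... | no ∣D∣≰3 = Bound-∁ (∣p∣≤n D)
    (subst₂ (λ d E → Bound k d (subsetSum (∁ D) h) (subsetSum E h))
      (∣∁p∣≡n∸∣p∣ D) (∁-involutive D)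
      (Bound-≤3 k∈67 ∣∁D∣≤3 (bounds (∁ D))))
    where
    ∣∁D∣≤3 : ∣ ∁ D ∣ ℕ.≤ 3
    ∣∁D∣≤3 = subst (ℕ._≤ 3) (sym (∣∁p∣≡n∸∣p∣ D))
               (ℕ.∸-mono (proj₂ (6≤k×k≤7 k∈67)) (ℕ.≰⇒> ∣D∣≰3))

mainTheorem7 : (k : ℕ) → (k ≡ 6 ⊎ k ≡ 7) → (h : Fin k → ℕ) →
    (∀ i j → i ≤ j → h i ≥ h j) → (∀ i → h i > 0) → LS k h →
    (D : Subset k) →
      (+ (k Data.Nat.+ 2) - + (3 Data.Nat.* ∣ D ∣)) * sumOver D h
        ≤ℤ (+ (2 Data.Nat.* k) - + 2 - + (3 Data.Nat.* ∣ D ∣)) * sumOver (∁ D) h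
mainTheorem7 k k∈67 h _ pos ls D =
  subst₂ (λ A B → lhsCoeff k ∣ D ∣ * A ≤ℤ rhsCoeff k ∣ D ∣ * B)
    (sym (sumOver≡+subsetSum D h)) (sym (sumOver≡+subsetSum (∁ D) h))
    (subsetSum-Bound k∈67 h (smallSetBounds h 2≤k (LS⇒hᵢ+[hᵢ+hⱼ]≤n ls pos)) D)
  where
  2≤k : 2 ℕ.≤ k
  2≤k = ≤-trans (ℕ.m≤m+n 2 4) (proj₁ (6≤k×k≤7 k∈67))
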